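{- Let $\mathcal L$ be a cartesian symmetric monoidal category in which $I=1\& 1$ is exponentiable. The following are equivalent: (1) for every object $X$, the morphisms $X\otimes w_0,X\otimes w_1\in\mathcal L(X\otimes1,X\otimes I)$ are jointly epic; (2) $(S,\pi_0,\pi_1,\sigma)$ is a pre-summability structure on $\mathcal L$.
   Context: $\mathcal L$ is a symmetric monoidal category $(\otimes,1,\rho,\lambda,\dots)$ enriched over pointed sets (each hom-set has a zero $0$, absorbing for composition, and $f\otimes0=0\otimes f=0$), with finite cartesian products $\&$. $I=1\& 1$ is exponentiable: $-\otimes I$ has a right adjoint $S=I\multimap-$, with evaluation $\mathrm{ev}\in\mathcal L((I\multimap X)\otimes I,X)$ and currying $\mathrm{cur}$. Let $w_0=\langle\mathrm{id}_1,0\rangle$, $w_1=\langle0,\mathrm{id}_1\rangle$, $\Delta=\langle\mathrm{id}_1,\mathrm{id}_1\rangle\in\mathcal L(1,I)$. For $\phi\in\mathcal L(1,I)$ define $\bar\phi_X=\mathrm{ev}\circ((I\multimap X)\otimes\phi)\circ\rho^{ -1}_{I\multimap X}\in\mathcal L(I\multimap X,X)$, natural in $X$; set $\pi_i=\bar w_i$ ($i=0,1$) and $\sigma=\bar\Delta$. A pre-summability structure on $\mathcal L$ is a tuple $(S,\pi_0,\pi_1,\sigma)$ with $S$ an endofunctor preserving zero morphisms and $\pi_0,\pi_1,\sigma:S\Rightarrow\mathrm{Id}$ natural transformations such that $\pi_0,\pi_1$ are jointly monic. -}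

module Defs where

open import Level using (Level; _⊔_; suc)
open import Relation.Binary.PropositionalEquality using (_≡_)


-- A symmetric monoidal category enriched over pointed sets (each hom-set
-- has a distinguished zero morphism, absorbing for composition and for ⊗),
-- with finite cartesian products (binary products _&_ and a terminal ⊤).
record PSMC (o ℓ : Level) : Set (suc (o ⊔ ℓ)) where
  infixr 9 _∘_
  infixr 10 _⊗₁_
  infixr 11 _⊗₀_
  infixr 12 _&_
  field
    Obj : Set o
    Hom : Obj → Obj → Set ℓ
    id  : ∀ {A} → Hom A A
    _∘_ : ∀ {A B C} → Hom B C → Hom A B → Hom A C
    identityˡ : ∀ {A B} (f : Hom A B) → id ∘ f ≡ f
    identityʳ : ∀ {A B} (f : Hom A B) → f ∘ id ≡ f
    assoc : ∀ {A B C D} (h : Hom C D) (g : Hom B C) (f : Hom A B) →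
            (h ∘ g) ∘ f ≡ h ∘ (g ∘ f)
    0m : ∀ {A B} → Hom A B
    zeroˡ : ∀ {A B C} (f : Hom A B) → 0m {B} {C} ∘ f ≡ 0m
    zeroʳ : ∀ {A B C} (g : Hom B C) → g ∘ 0m {A} {B} ≡ 0m
    _⊗₀_ : Obj → Obj → Obj
    _⊗₁_ : ∀ {A B C D} → Hom A B → Hom C D → Hom (A ⊗₀ C) (B ⊗₀ D)
    ⊗-id : ∀ {A B} → id {A} ⊗₁ id {B} ≡ id
    ⊗-∘ : ∀ {A B C D E F} (f : Hom B C) (g : Hom A B) (h : Hom E F) (k : Hom D E) →
          (f ∘ g) ⊗₁ (h ∘ k) ≡ (f ⊗₁ h) ∘ (g ⊗₁ k)
    ⊗-zeroʳ : ∀ {A B C D} (f : Hom A B) → f ⊗₁ 0m {C} {D} ≡ 0m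
    ⊗-zeroˡ : ∀ {A B C D} (f : Hom C D) → 0m {A} {B} ⊗₁ f ≡ 0m
    𝟙 : Obj
    λ⇒ : ∀ {A} → Hom (𝟙 ⊗₀ A) A
    λ⇐ : ∀ {A} → Hom A (𝟙 ⊗₀ A)
    λ-isoˡ : ∀ {A} → λ⇐ {A} ∘ λ⇒ ≡ id
    λ-isoʳ : ∀ {A} → λ⇒ {A} ∘ λ⇐ ≡ id
    λ-nat : ∀ {A B} (f : Hom A B) → λ⇒ ∘ (id {𝟙} ⊗₁ f) ≡ f ∘ λ⇒
    ρ⇒ : ∀ {A} → Hom (A ⊗₀ 𝟙) A
    ρ⇐ : ∀ {A} → Hom A (A ⊗₀ 𝟙)
    ρ-isoˡ : ∀ {A} → ρ⇐ {A} ∘ ρ⇒ ≡ id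
    ρ-isoʳ : ∀ {A} → ρ⇒ {A} ∘ ρ⇐ ≡ id
    ρ-nat : ∀ {A B} (f : Hom A B) → ρ⇒ ∘ (f ⊗₁ id {𝟙}) ≡ f ∘ ρ⇒
    α⇒ : ∀ {A B C} → Hom ((A ⊗₀ B) ⊗₀ C) (A ⊗₀ (B ⊗₀ C))
    α⇐ : ∀ {A B C} → Hom (A ⊗₀ (B ⊗₀ C)) ((A ⊗₀ B) ⊗₀ C)
    α-isoˡ : ∀ {A B C} → α⇐ {A} {B} {C} ∘ α⇒ ≡ id
    α-isoʳ : ∀ {A B C} → α⇒ {A} {B} {C} ∘ α⇐ ≡ id
    α-nat : ∀ {A A' B B' C C'} (f : Hom A A') (g : Hom B B') (h : Hom C C') →
            α⇒ ∘ ((f ⊗₁ g) ⊗₁ h) ≡ (f ⊗₁ (g ⊗₁ h)) ∘ α⇒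
    triangle : ∀ {A B} → (id {A} ⊗₁ λ⇒ {B}) ∘ α⇒ ≡ ρ⇒ ⊗₁ id
    pentagon : ∀ {A B C D} →
               (id {A} ⊗₁ α⇒ {B} {C} {D}) ∘ α⇒ ∘ (α⇒ ⊗₁ id) ≡ α⇒ ∘ α⇒
    γ : ∀ {A B} → Hom (A ⊗₀ B) (B ⊗₀ A)
    γ-nat : ∀ {A A' B B'} (f : Hom A A') (g : Hom B B') →
            γ ∘ (f ⊗₁ g) ≡ (g ⊗₁ f) ∘ γ
    γ-inv : ∀ {A B} → γ {B} {A} ∘ γ {A} {B} ≡ id
    hexagon : ∀ {A B C} →
              α⇒ {B} {C} {A} ∘ γ ∘ α⇒ ≡ (id ⊗₁ γ) ∘ α⇒ ∘ (γ ⊗₁ id {C})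
    ⊤ : Obj
    ! : ∀ {A} → Hom A ⊤
    !-unique : ∀ {A} (f : Hom A ⊤) → f ≡ !
    _&_ : Obj → Obj → Obj
    p₁ : ∀ {A B} → Hom (A & B) A
    p₂ : ∀ {A B} → Hom (A & B) B
    ⟨_,_⟩ : ∀ {A B C} → Hom C A → Hom C B → Hom C (A & B)
    p₁-β : ∀ {A B C} (f : Hom C A) (g : Hom C B) → p₁ ∘ ⟨ f , g ⟩ ≡ f
    p₂-β : ∀ {A B C} (f : Hom C A) (g : Hom C B) → p₂ ∘ ⟨ f , g ⟩ ≡ g
    ⟨⟩-unique : ∀ {A B C} (f : Hom C A) (g : Hom C B) (h : Hom C (A & B)) →
                p₁ ∘ h ≡ f → p₂ ∘ h ≡ g → h ≡ ⟨ f , g ⟩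

module _ {o ℓ : Level} (L : PSMC o ℓ) where
  open PSMC L

  I : Obj
  I = 𝟙 & 𝟙

  w₀ w₁ Δ : Hom 𝟙 I
  w₀ = ⟨ id , 0m ⟩
  w₁ = ⟨ 0m , id ⟩
  Δ  = ⟨ id , id ⟩

  record IExponentiable : Set (o ⊔ ℓ) where
    field
      _⊸ : Obj → Obj              -- X ↦ I ⊸ X
      ev : ∀ {X} → Hom ((X ⊸) ⊗₀ I) X
      cur : ∀ {Z X} → Hom (Z ⊗₀ I) X → Hom Z (X ⊸)
      ev-β : ∀ {Z X} (f : Hom (Z ⊗₀ I) X) → ev ∘ (cur f ⊗₁ id) ≡ f
      cur-unique : ∀ {Z X} (f : Hom (Z ⊗₀ I) X) (g : Hom Z (X ⊸)) →
                   ev ∘ (g ⊗₁ id) ≡ f → g ≡ cur f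

  JointlyEpic : ∀ {A B} (f g : Hom A B) → Set (o ⊔ ℓ)
  JointlyEpic {A} {B} f g = ∀ {C} (h k : Hom B C) →
    h ∘ f ≡ k ∘ f → h ∘ g ≡ k ∘ g → h ≡ k

  JointlyMonic : ∀ {A B} (f g : Hom A B) → Set (o ⊔ ℓ)
  JointlyMonic {A} {B} f g = ∀ {C} (h k : Hom C A) →
    f ∘ h ≡ f ∘ k → g ∘ h ≡ g ∘ k → h ≡ k

  TensorWJointlyEpic : Set (o ⊔ ℓ)
  TensorWJointlyEpic = ∀ X → JointlyEpic (id {X} ⊗₁ w₀) (id {X} ⊗₁ w₁)

  record IsPreSummability
      (S₀ : Obj → Obj) (S₁ : ∀ {A B} → Hom A B → Hom (S₀ A) (S₀ B))
      (π₀ π₁ σ : ∀ X → Hom (S₀ X) X) : Set (o ⊔ ℓ) where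
    field
      S-id : ∀ {A} → S₁ (id {A}) ≡ id
      S-∘ : ∀ {A B C} (g : Hom B C) (f : Hom A B) → S₁ (g ∘ f) ≡ S₁ g ∘ S₁ f
      S-zero : ∀ {A B} → S₁ (0m {A} {B}) ≡ 0m
      π₀-nat : ∀ {A B} (f : Hom A B) → π₀ B ∘ S₁ f ≡ f ∘ π₀ A
      π₁-nat : ∀ {A B} (f : Hom A B) → π₁ B ∘ S₁ f ≡ f ∘ π₁ A
      σ-nat : ∀ {A B} (f : Hom A B) → σ B ∘ S₁ f ≡ f ∘ σ A
      π-jointly-monic : ∀ X → JointlyMonic (π₀ X) (π₁ X)

  module _ (E : IExponentiable) where
    open IExponentiable E

    S₀ : Obj → Obj
    S₀ X = X ⊸

    S₁ : ∀ {A B} → Hom A B → Hom (S₀ A) (S₀ B)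
    S₁ f = cur (f ∘ ev)

    bar : Hom 𝟙 I → ∀ X → Hom (S₀ X) X
    bar φ X = ev ∘ (id ⊗₁ φ) ∘ ρ⇐

    π₀ π₁ σ : ∀ X → Hom (S₀ X) X
    π₀ = bar w₀
    π₁ = bar w₁
    σ  = bar Δ

    IsPreSummabilityStructure : Set (o ⊔ ℓ)
    IsPreSummabilityStructure = IsPreSummability S₀ S₁ π₀ π₁ σ

{-# OPTIONS --safe #-}
module Submission where

-- Currying identifies maps C → I ⊸ X with maps C ⊗ I → X, and under this
-- bijection postcomposition with φ̄_X becomes precomposition with C ⊗ φ
-- (up to the unitor ρ).  Hence the φ̄_X, ψ̄_X are jointly monic for every X
-- exactly when the C ⊗ φ, C ⊗ ψ are jointly epic for every C.  The remaining
-- pre-summability axioms hold unconditionally: I ⊸ - is a functor preserving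
-- zero, and every φ̄ is natural.

open import Defs
open import Level using (Level)
open import Function.Bundles using (_⇔_; mk⇔; Equivalence)
open import Relation.Binary.PropositionalEquality using (_≡_; refl; sym; trans; cong; module ≡-Reasoning)

module Monoidal {o ℓ : Level} (L : PSMC o ℓ) where
  open PSMC L
  open ≡-Reasoning

  split-epi-cancelʳ : ∀ {A B C} {e : Hom A B} {s : Hom B A} → e ∘ s ≡ id →
                      {a b : Hom B C} → a ∘ e ≡ b ∘ e → a ≡ b
  split-epi-cancelʳ {e = e} {s} es {a} {b} ae≡be = begin
    a             ≡⟨ sym (identityʳ a) ⟩
    a ∘ id        ≡⟨ cong (a ∘_) (sym es) ⟩
    a ∘ e ∘ s     ≡⟨ sym (assoc a e s) ⟩
    (a ∘ e) ∘ s   ≡⟨ cong (_∘ s) ae≡be ⟩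
    (b ∘ e) ∘ s   ≡⟨ assoc b e s ⟩
    b ∘ e ∘ s     ≡⟨ cong (b ∘_) es ⟩
    b ∘ id        ≡⟨ identityʳ b ⟩
    b             ∎

  split-mono-cancelˡ : ∀ {A B C} {m : Hom A B} {r : Hom B A} → r ∘ m ≡ id →
                       {a b : Hom C A} → m ∘ a ≡ m ∘ b → a ≡ b
  split-mono-cancelˡ {m = m} {r} rm {a} {b} ma≡mb = begin
    a             ≡⟨ sym (identityˡ a) ⟩
    id ∘ a        ≡⟨ cong (_∘ a) (sym rm) ⟩
    (r ∘ m) ∘ a   ≡⟨ assoc r m a ⟩
    r ∘ m ∘ a     ≡⟨ cong (r ∘_) ma≡mb ⟩
    r ∘ m ∘ b     ≡⟨ sym (assoc r m b) ⟩
    (r ∘ m) ∘ b   ≡⟨ cong (_∘ b) rm ⟩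
    id ∘ b        ≡⟨ identityˡ b ⟩
    b             ∎

  ρ⇐-nat : ∀ {A B} (g : Hom A B) → ρ⇐ ∘ g ≡ (g ⊗₁ id) ∘ ρ⇐
  ρ⇐-nat g = split-mono-cancelˡ ρ-isoˡ (begin
    ρ⇒ ∘ ρ⇐ ∘ g                ≡⟨ sym (assoc ρ⇒ ρ⇐ g) ⟩
    (ρ⇒ ∘ ρ⇐) ∘ g              ≡⟨ cong (_∘ g) ρ-isoʳ ⟩
    id ∘ g                     ≡⟨ identityˡ g ⟩
    g                          ≡⟨ sym (identityʳ g) ⟩
    g ∘ id                     ≡⟨ cong (g ∘_) (sym ρ-isoʳ) ⟩
    g ∘ ρ⇒ ∘ ρ⇐                ≡⟨ sym (assoc g ρ⇒ ρ⇐) ⟩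
    (g ∘ ρ⇒) ∘ ρ⇐              ≡⟨ cong (_∘ ρ⇐) (sym (ρ-nat g)) ⟩
    (ρ⇒ ∘ (g ⊗₁ id)) ∘ ρ⇐      ≡⟨ assoc ρ⇒ (g ⊗₁ id) ρ⇐ ⟩
    ρ⇒ ∘ (g ⊗₁ id) ∘ ρ⇐        ∎)

  ⊗-interchange : ∀ {A B C D} (g : Hom A B) (φ : Hom C D) →
                  (id ⊗₁ φ) ∘ (g ⊗₁ id) ≡ (g ⊗₁ id) ∘ (id ⊗₁ φ)
  ⊗-interchange g φ = begin
    (id ⊗₁ φ) ∘ (g ⊗₁ id)    ≡⟨ sym (⊗-∘ id g φ id) ⟩
    (id ∘ g) ⊗₁ (φ ∘ id)     ≡⟨ cong (_⊗₁ (φ ∘ id)) (trans (identityˡ g) (sym (identityʳ g))) ⟩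
    (g ∘ id) ⊗₁ (φ ∘ id)     ≡⟨ cong ((g ∘ id) ⊗₁_) (trans (identityʳ φ) (sym (identityˡ φ))) ⟩
    (g ∘ id) ⊗₁ (id ∘ φ)     ≡⟨ ⊗-∘ g id id φ ⟩
    (g ⊗₁ id) ∘ (id ⊗₁ φ)    ∎

  ⊗-∘ˡ : ∀ {A B C D} (g : Hom B C) (f : Hom A B) → (g ∘ f) ⊗₁ id {D} ≡ (g ⊗₁ id) ∘ (f ⊗₁ id)
  ⊗-∘ˡ g f = trans (cong ((g ∘ f) ⊗₁_) (sym (identityˡ id))) (⊗-∘ g f id id)

module Exponential {o ℓ : Level} (L : PSMC o ℓ) (E : IExponentiable L) where
  open PSMC L
  open IExponentiable E
  open Monoidal L
  open ≡-Reasoning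

  uncur : ∀ {C X} → Hom C (X ⊸) → Hom (C ⊗₀ I L) X
  uncur g = ev ∘ (g ⊗₁ id)

  cur-uncur : ∀ {C X} {f : Hom (C ⊗₀ I L) X} {g : Hom C (X ⊸)} → uncur g ≡ f → cur f ≡ g
  cur-uncur {f = f} {g} e = sym (cur-unique f g e)

  uncur-injective : ∀ {C X} {g h : Hom C (X ⊸)} → uncur g ≡ uncur h → g ≡ h
  uncur-injective e = trans (sym (cur-uncur refl)) (cur-uncur (sym e))

  uncur-∘ : ∀ {A C X} (g : Hom C (X ⊸)) (f : Hom A C) → uncur (g ∘ f) ≡ uncur g ∘ (f ⊗₁ id)
  uncur-∘ g f = trans (cong (ev ∘_) (⊗-∘ˡ g f)) (sym (assoc ev (g ⊗₁ id) (f ⊗₁ id)))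

  S-id : ∀ {A} → S₁ L E (id {A}) ≡ id
  S-id = cur-uncur (begin
    ev ∘ (id ⊗₁ id)   ≡⟨ cong (ev ∘_) ⊗-id ⟩
    ev ∘ id           ≡⟨ identityʳ ev ⟩
    ev                ≡⟨ sym (identityˡ ev) ⟩
    id ∘ ev           ∎)

  S-∘ : ∀ {A B C} (g : Hom B C) (f : Hom A B) → S₁ L E (g ∘ f) ≡ S₁ L E g ∘ S₁ L E f
  S-∘ g f = cur-uncur (begin
    uncur (S₁ L E g ∘ S₁ L E f)          ≡⟨ uncur-∘ (S₁ L E g) (S₁ L E f) ⟩
    uncur (S₁ L E g) ∘ (S₁ L E f ⊗₁ id)  ≡⟨ cong (_∘ (S₁ L E f ⊗₁ id)) (ev-β (g ∘ ev)) ⟩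
    (g ∘ ev) ∘ (S₁ L E f ⊗₁ id)          ≡⟨ assoc g ev (S₁ L E f ⊗₁ id) ⟩
    g ∘ uncur (S₁ L E f)                 ≡⟨ cong (g ∘_) (ev-β (f ∘ ev)) ⟩
    g ∘ f ∘ ev                           ≡⟨ sym (assoc g f ev) ⟩
    (g ∘ f) ∘ ev                         ∎)

  S-zero : ∀ {A B} → S₁ L E (0m {A} {B}) ≡ 0m
  S-zero = cur-uncur (begin
    ev ∘ (0m ⊗₁ id)   ≡⟨ cong (ev ∘_) (⊗-zeroˡ id) ⟩
    ev ∘ 0m           ≡⟨ zeroʳ ev ⟩
    0m                ≡⟨ sym (zeroˡ ev) ⟩
    0m ∘ ev           ∎)

  bar-∘ : ∀ (φ : Hom 𝟙 (I L)) {C X} (g : Hom C (X ⊸)) →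
          bar L E φ X ∘ g ≡ (uncur g ∘ (id ⊗₁ φ)) ∘ ρ⇐
  bar-∘ φ g = begin
    (ev ∘ (id ⊗₁ φ) ∘ ρ⇐) ∘ g           ≡⟨ assoc ev _ g ⟩
    ev ∘ ((id ⊗₁ φ) ∘ ρ⇐) ∘ g           ≡⟨ cong (ev ∘_) (assoc (id ⊗₁ φ) ρ⇐ g) ⟩
    ev ∘ (id ⊗₁ φ) ∘ ρ⇐ ∘ g             ≡⟨ cong (λ x → ev ∘ (id ⊗₁ φ) ∘ x) (ρ⇐-nat g) ⟩
    ev ∘ (id ⊗₁ φ) ∘ (g ⊗₁ id) ∘ ρ⇐     ≡⟨ cong (ev ∘_) (sym (assoc (id ⊗₁ φ) (g ⊗₁ id) ρ⇐)) ⟩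
    ev ∘ ((id ⊗₁ φ) ∘ (g ⊗₁ id)) ∘ ρ⇐   ≡⟨ cong (λ x → ev ∘ x ∘ ρ⇐) (⊗-interchange g φ) ⟩
    ev ∘ ((g ⊗₁ id) ∘ (id ⊗₁ φ)) ∘ ρ⇐   ≡⟨ cong (ev ∘_) (assoc (g ⊗₁ id) (id ⊗₁ φ) ρ⇐) ⟩
    ev ∘ (g ⊗₁ id) ∘ (id ⊗₁ φ) ∘ ρ⇐     ≡⟨ sym (assoc ev (g ⊗₁ id) _) ⟩
    uncur g ∘ (id ⊗₁ φ) ∘ ρ⇐            ≡⟨ sym (assoc (uncur g) (id ⊗₁ φ) ρ⇐) ⟩
    (uncur g ∘ (id ⊗₁ φ)) ∘ ρ⇐          ∎

  bar-natural : ∀ (φ : Hom 𝟙 (I L)) {A B} (f : Hom A B) →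
                bar L E φ B ∘ S₁ L E f ≡ f ∘ bar L E φ A
  bar-natural φ f = begin
    bar L E φ _ ∘ S₁ L E f                       ≡⟨ bar-∘ φ (S₁ L E f) ⟩
    (uncur (S₁ L E f) ∘ (id ⊗₁ φ)) ∘ ρ⇐          ≡⟨ cong (λ x → (x ∘ (id ⊗₁ φ)) ∘ ρ⇐) (ev-β (f ∘ ev)) ⟩
    ((f ∘ ev) ∘ (id ⊗₁ φ)) ∘ ρ⇐                  ≡⟨ assoc (f ∘ ev) (id ⊗₁ φ) ρ⇐ ⟩
    (f ∘ ev) ∘ (id ⊗₁ φ) ∘ ρ⇐                    ≡⟨ assoc f ev _ ⟩
    f ∘ bar L E φ _                              ∎

  bar-∘-≡⇔ : ∀ (φ : Hom 𝟙 (I L)) {C X} (g h : Hom C (X ⊸)) →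
             (bar L E φ X ∘ g ≡ bar L E φ X ∘ h) ⇔ (uncur g ∘ (id ⊗₁ φ) ≡ uncur h ∘ (id ⊗₁ φ))
  bar-∘-≡⇔ φ g h = mk⇔
    (λ e → split-epi-cancelʳ ρ-isoˡ (trans (sym (bar-∘ φ g)) (trans e (bar-∘ φ h))))
    (λ e → trans (bar-∘ φ g) (trans (cong (_∘ ρ⇐) e) (sym (bar-∘ φ h))))

  ⊗-jointlyEpic⇔bar-jointlyMonic : ∀ (φ ψ : Hom 𝟙 (I L)) →
    (∀ C → JointlyEpic L (id {C} ⊗₁ φ) (id ⊗₁ ψ)) ⇔ (∀ X → JointlyMonic L (bar L E φ X) (bar L E ψ X))
  ⊗-jointlyEpic⇔bar-jointlyMonic φ ψ = mk⇔ monic epic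
    where
    monic : (∀ C → JointlyEpic L (id {C} ⊗₁ φ) (id ⊗₁ ψ)) → ∀ X → JointlyMonic L (bar L E φ X) (bar L E ψ X)
    monic jointlyEpic X g h eφ eψ = uncur-injective (jointlyEpic _ (uncur g) (uncur h)
      (Equivalence.to (bar-∘-≡⇔ φ g h) eφ) (Equivalence.to (bar-∘-≡⇔ ψ g h) eψ))

    epic : (∀ X → JointlyMonic L (bar L E φ X) (bar L E ψ X)) → ∀ C → JointlyEpic L (id {C} ⊗₁ φ) (id ⊗₁ ψ)
    epic jointlyMonic C f g eφ eψ = begin
      f                ≡⟨ sym (ev-β f) ⟩
      uncur (cur f)    ≡⟨ cong uncur cur-f≡cur-g ⟩
      uncur (cur g)    ≡⟨ ev-β g ⟩
      g                ∎
      where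
      precompose-cur : ∀ χ → f ∘ (id ⊗₁ χ) ≡ g ∘ (id ⊗₁ χ) →
                       bar L E χ _ ∘ cur f ≡ bar L E χ _ ∘ cur g
      precompose-cur χ e = Equivalence.from (bar-∘-≡⇔ χ (cur f) (cur g))
        (trans (cong (_∘ (id ⊗₁ χ)) (ev-β f)) (trans e (cong (_∘ (id ⊗₁ χ)) (sym (ev-β g)))))

      cur-f≡cur-g : cur f ≡ cur g
      cur-f≡cur-g = jointlyMonic _ (cur f) (cur g) (precompose-cur φ eφ) (precompose-cur ψ eψ)

mainTheorem9 : ∀ {o ℓ : Level} (L : PSMC o ℓ) (E : IExponentiable L) →
    TensorWJointlyEpic L ⇔ IsPreSummabilityStructure L E
mainTheorem9 L E = mk⇔
  (λ jointlyEpic → record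
    { S-id = S-id ; S-∘ = S-∘ ; S-zero = S-zero
    ; π₀-nat = bar-natural (w₀ L) ; π₁-nat = bar-natural (w₁ L) ; σ-nat = bar-natural (Δ L)
    ; π-jointly-monic = Equivalence.to π-criterion jointlyEpic
    })
  (λ preSummability → Equivalence.from π-criterion (IsPreSummability.π-jointly-monic preSummability))
  where
  open Exponential L E
  π-criterion : TensorWJointlyEpic L ⇔ (∀ X → JointlyMonic L (π₀ L E X) (π₁ L E X))
  π-criterion = ⊗-jointlyEpic⇔bar-jointlyMonic (w₀ L) (w₁ L)
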